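{- Let $n\geq1$, let $\mathcal{H}$ be a non-empty hereditary sub-family of $2^{[n]}$ with $\mathcal{H}\neq\{\emptyset\}$, and let $\mathcal{S}$ be a largest star of $\mathcal{H}$. Consider pairs $\mathcal{A}_1,\mathcal{A}_2$ of cross-intersecting sub-families of $\mathcal{H}$. (i) If $2\leq|\mathcal{H}|/|\mathcal{S}|$, then $|\mathcal{A}_1|+|\mathcal{A}_2|$ is maximum when $\mathcal{A}_1=\mathcal{H}$ and $\mathcal{A}_2=\emptyset$. (ii) If $2\geq|\mathcal{H}|/|\mathcal{S}|$, then $|\mathcal{A}_1|+|\mathcal{A}_2|$ is maximum when $\mathcal{A}_1=\mathcal{A}_2=\mathcal{S}$.
   Context: $[n]=\{1,\dots,n\}$. A family $\mathcal{H}$ is hereditary if all subsets of any set in $\mathcal{H}$ are in $\mathcal{H}$. For $y\in[n]$, the star $\mathcal{H}\langle y\rangle=\{H\in\mathcal{H}:y\in H\}$; a largest star is one of maximum size. Two families $\mathcal{A}_1,\mathcal{A}_2$ (not necessarily distinct or non-empty) are cross-intersecting if every set in $\mathcal{A}_1$ intersects every set in $\mathcal{A}_2$. -}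

module Defs where

open import Data.Nat using (ℕ; zero; suc)
open import Data.Bool using (Bool; true; false; _∧_)
open import Data.Fin using (Fin)
open import Data.Fin.Subset using (Subset; _⊆_; _∩_; Nonempty; inside; outside)
open import Data.Vec using (Vec; []; _∷_; lookup)
open import Data.List using (List; []; _∷_; _++_; map; filter; length)
open import Data.Bool.Properties using (T?)
open import Relation.Binary.PropositionalEquality using (_≡_)

Family : ℕ → Set
Family n = Subset n → Bool

_∈F_ : ∀ {n} → Subset n → Family n → Set
X ∈F 𝓕 = 𝓕 X ≡ true

-- list of all 2^n subsets of [n], each exactly once
allSubsets : (n : ℕ) → List (Subset n)
allSubsets zero = [] ∷ []
allSubsets (suc n) = map (inside ∷_) (allSubsets n) ++ map (outside ∷_) (allSubsets n)

∣_∣F : ∀ {n} → Family n → ℕ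
∣_∣F {n} 𝓕 = length (filter (λ X → T? (𝓕 X)) (allSubsets n))

_⊆F_ : ∀ {n} → Family n → Family n → Set
𝓐 ⊆F 𝓑 = ∀ X → X ∈F 𝓐 → X ∈F 𝓑

Hereditary : ∀ {n} → Family n → Set
Hereditary 𝓗 = ∀ X Y → Y ⊆ X → X ∈F 𝓗 → Y ∈F 𝓗

star : ∀ {n} → Family n → Fin n → Family n
star 𝓗 y X = 𝓗 X ∧ lookup X y

IsLargestStar : ∀ {n} → Family n → Family n → Set
IsLargestStar {n} 𝓗 𝓢 =
  Data.Product.Σ (Fin n) (λ y → (∀ X → 𝓢 X ≡ star 𝓗 y X) Data.Product.× (∀ z → ∣ star 𝓗 z ∣F Data.Nat.≤ ∣ star 𝓗 y ∣F))
  where import Data.Product ; import Data.Nat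

∅F : ∀ {n} → Family n
∅F _ = false

CrossIntersecting : ∀ {n} → Family n → Family n → Set
CrossIntersecting 𝓐₁ 𝓐₂ = ∀ X Y → X ∈F 𝓐₁ → Y ∈F 𝓐₂ → Nonempty (X ∩ Y)

-- Split on the first element: if 𝓐, 𝓑 ⊆ 𝓗 are cross-intersecting and 𝓗 is
-- hereditary, then (𝓐 ↾ in, 𝓑 ↾ in ∩ 𝓑 ↾ out) is a cross-intersecting pair in
-- 𝓗 ↾ in and (𝓐 ↾ out, 𝓑 ↾ in ∪ 𝓑 ↾ out) one in 𝓗 ↾ out (heredity puts
-- 𝓑 ↾ in inside 𝓗 ↾ out).  By inclusion–exclusion these pairs have the same
-- total size as (𝓐, 𝓑), so induction gives |𝓐| + |𝓑| ≤ |𝓗|.  This bound is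
-- attained by (𝓗, ∅), and since a star meets itself, (𝓢, 𝓢) attains it too
-- when 2|𝓢| ≥ |𝓗|.
module Submission where

open import Defs
open import Data.Nat using (ℕ; zero; suc; _≤_; _*_; _+_; z≤n; s≤s)
open import Data.Nat.Properties
  using (≤-trans; ≤-reflexive; m≤m+n; +-mono-≤; +-suc; +-identityʳ; +-commutativeSemigroup; module ≤-Reasoning)
open import Algebra.Properties.CommutativeSemigroup +-commutativeSemigroup using (interchange)
open import Data.Bool using (Bool; true; false; _∧_; _∨_)
open import Data.Bool.Properties using (T?; ∧-conicalˡ; ∧-conicalʳ)
open import Data.Fin using (Fin) renaming (suc to fsuc)
open import Data.Fin.Subset using (Subset; ⊥; _∩_; Nonempty; inside; outside)
open import Data.Fin.Subset.Properties using (s⊆s; out⊆; ⊆-refl; x∈p∩q⁺)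
open import Data.Vec using ([]; _∷_; there)
open import Data.Vec.Properties using (lookup⇒[]=)
open import Data.List using (List; []; _∷_; _++_; map; filter; length)
open import Data.List.Properties using (length-++; filter-++)
open import Data.Product using (Σ; _×_; _,_; proj₁)
open import Relation.Binary.PropositionalEquality using (_≡_; refl; sym; trans; cong; cong₂; subst)
open import Relation.Nullary using (¬_)
open import Function.Bundles using (_⇔_)

private
  variable
    n : ℕ

count : (Subset n → Bool) → List (Subset n) → ℕ
count 𝓕 xs = length (filter (λ X → T? (𝓕 X)) xs)

count-++ : (𝓕 : Family n) (xs ys : List (Subset n)) →
           count 𝓕 (xs ++ ys) ≡ count 𝓕 xs + count 𝓕 ys
count-++ 𝓕 xs ys =
  trans (cong length (filter-++ (λ X → T? (𝓕 X)) xs ys)) (length-++ (filter _ xs))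

count-map : ∀ {m} (𝓕 : Family n) (f : Subset m → Subset n) (xs : List (Subset m)) →
            count 𝓕 (map f xs) ≡ count (λ X → 𝓕 (f X)) xs
count-map 𝓕 f [] = refl
count-map 𝓕 f (x ∷ xs) with 𝓕 (f x)
... | true  = cong suc (count-map 𝓕 f xs)
... | false = count-map 𝓕 f xs

count-∧+count-∨ : (𝓕 𝓖 : Family n) (xs : List (Subset n)) →
                  count (λ X → 𝓕 X ∧ 𝓖 X) xs + count (λ X → 𝓕 X ∨ 𝓖 X) xs ≡ count 𝓕 xs + count 𝓖 xs
count-∧+count-∨ 𝓕 𝓖 [] = refl
count-∧+count-∨ 𝓕 𝓖 (x ∷ xs) with ih ← count-∧+count-∨ 𝓕 𝓖 xs | 𝓕 x | 𝓖 x
... | true  | true  = cong suc (trans (+-suc _ _) (trans (cong suc ih) (sym (+-suc _ _))))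
... | true  | false = trans (+-suc _ _) (cong suc ih)
... | false | true  = trans (+-suc _ _) (trans (cong suc ih) (sym (+-suc _ _)))
... | false | false = ih

-- 𝓕 ↾ inside is the link and 𝓕 ↾ outside the deletion of 𝓕 at the first element.
_↾_ : Family (suc n) → Bool → Family n
(𝓕 ↾ b) X = 𝓕 (b ∷ X)

_∩F_ _∪F_ : Family n → Family n → Family n
(𝓐 ∩F 𝓑) X = 𝓐 X ∧ 𝓑 X
(𝓐 ∪F 𝓑) X = 𝓐 X ∨ 𝓑 X

∣∣F-↾ : (𝓕 : Family (suc n)) → ∣ 𝓕 ∣F ≡ ∣ 𝓕 ↾ inside ∣F + ∣ 𝓕 ↾ outside ∣F
∣∣F-↾ {n} 𝓕 = trans (count-++ 𝓕 (map (inside ∷_) (allSubsets n)) (map (outside ∷_) (allSubsets n)))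
                     (cong₂ _+_ (count-map 𝓕 (inside ∷_) (allSubsets n))
                                (count-map 𝓕 (outside ∷_) (allSubsets n)))

∣∩F∣+∣∪F∣ : (𝓐 𝓑 : Family n) → ∣ 𝓐 ∩F 𝓑 ∣F + ∣ 𝓐 ∪F 𝓑 ∣F ≡ ∣ 𝓐 ∣F + ∣ 𝓑 ∣F
∣∩F∣+∣∪F∣ {n} 𝓐 𝓑 = count-∧+count-∨ 𝓐 𝓑 (allSubsets n)

∩F-⊆Fˡ : (𝓐 𝓑 : Family n) → (𝓐 ∩F 𝓑) ⊆F 𝓐
∩F-⊆Fˡ 𝓐 𝓑 X = ∧-conicalˡ (𝓐 X) (𝓑 X)

∩F-⊆Fʳ : (𝓐 𝓑 : Family n) → (𝓐 ∩F 𝓑) ⊆F 𝓑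
∩F-⊆Fʳ 𝓐 𝓑 X = ∧-conicalʳ (𝓐 X) (𝓑 X)

∪F-least : {𝓐 𝓑 𝓒 : Family n} → 𝓐 ⊆F 𝓒 → 𝓑 ⊆F 𝓒 → (𝓐 ∪F 𝓑) ⊆F 𝓒
∪F-least {𝓐 = 𝓐} 𝓐⊆𝓒 𝓑⊆𝓒 X X∈𝓐∪𝓑 with 𝓐 X in X∈𝓐
... | true  = 𝓐⊆𝓒 X X∈𝓐
... | false = 𝓑⊆𝓒 X X∈𝓐∪𝓑

⊆F-↾ : {𝓐 𝓑 : Family (suc n)} (b : Bool) → 𝓐 ⊆F 𝓑 → (𝓐 ↾ b) ⊆F (𝓑 ↾ b)
⊆F-↾ b 𝓐⊆𝓑 X = 𝓐⊆𝓑 (b ∷ X)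

Hereditary-↾ : {𝓗 : Family (suc n)} (b : Bool) → Hereditary 𝓗 → Hereditary (𝓗 ↾ b)
Hereditary-↾ b hered X Y Y⊆X = hered (b ∷ X) (b ∷ Y) (s⊆s Y⊆X)

↾inside-⊆F-↾outside : {𝓗 : Family (suc n)} → Hereditary 𝓗 → (𝓗 ↾ inside) ⊆F (𝓗 ↾ outside)
↾inside-⊆F-↾outside hered X = hered (inside ∷ X) (outside ∷ X) (out⊆ ⊆-refl)

CrossIntersecting-⊆Fʳ : {𝓐 𝓑 𝓒 : Family n} → CrossIntersecting 𝓐 𝓑 → 𝓒 ⊆F 𝓑 → CrossIntersecting 𝓐 𝓒
CrossIntersecting-⊆Fʳ cross 𝓒⊆𝓑 X Y X∈𝓐 Y∈𝓒 = cross X Y X∈𝓐 (𝓒⊆𝓑 Y Y∈𝓒)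

CrossIntersecting-∪F : {𝓐 𝓑 𝓒 : Family n} →
  CrossIntersecting 𝓐 𝓑 → CrossIntersecting 𝓐 𝓒 → CrossIntersecting 𝓐 (𝓑 ∪F 𝓒)
CrossIntersecting-∪F {𝓑 = 𝓑} cross₁ cross₂ X Y X∈𝓐 Y∈𝓑∪𝓒 with 𝓑 Y in Y∈𝓑
... | true  = cross₁ X Y X∈𝓐 Y∈𝓑
... | false = cross₂ X Y X∈𝓐 Y∈𝓑∪𝓒

CrossIntersecting-↾ : {𝓐 𝓑 : Family (suc n)} (b c : Bool) → b ∧ c ≡ false →
  CrossIntersecting 𝓐 𝓑 → CrossIntersecting (𝓐 ↾ b) (𝓑 ↾ c)
CrossIntersecting-↾ b c b∧c≡false cross X Y X∈𝓐 Y∈𝓑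
  with fsuc i , there i∈X∩Y ← subst (λ d → Nonempty (d ∷ (X ∩ Y))) b∧c≡false
                                                  (cross (b ∷ X) (c ∷ Y) X∈𝓐 Y∈𝓑)
  = i , i∈X∩Y

∣𝓐∣+∣𝓑∣≤∣𝓗∣ : (𝓗 𝓐 𝓑 : Family n) → Hereditary 𝓗 → 𝓐 ⊆F 𝓗 → 𝓑 ⊆F 𝓗 →
              CrossIntersecting 𝓐 𝓑 → ∣ 𝓐 ∣F + ∣ 𝓑 ∣F ≤ ∣ 𝓗 ∣F
∣𝓐∣+∣𝓑∣≤∣𝓗∣ {zero} 𝓗 𝓐 𝓑 _ 𝓐⊆𝓗 𝓑⊆𝓗 cross with 𝓐 [] in []∈𝓐 | 𝓑 [] in []∈𝓑 | 𝓗 [] in []∈𝓗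
... | true  | true  | _     with () ← proj₁ (cross [] [] []∈𝓐 []∈𝓑)
... | true  | false | true  = s≤s z≤n
... | false | true  | true  = s≤s z≤n
... | false | false | _     = z≤n
... | true  | false | false with () ← trans (sym []∈𝓗) (𝓐⊆𝓗 [] []∈𝓐)
... | false | true  | false with () ← trans (sym []∈𝓗) (𝓑⊆𝓗 [] []∈𝓑)
∣𝓐∣+∣𝓑∣≤∣𝓗∣ {suc n} 𝓗 𝓐 𝓑 hered 𝓐⊆𝓗 𝓑⊆𝓗 cross = begin
  ∣ 𝓐 ∣F + ∣ 𝓑 ∣F
    ≡⟨ cong₂ _+_ (∣∣F-↾ 𝓐) (∣∣F-↾ 𝓑) ⟩
  (∣ 𝓐₁ ∣F + ∣ 𝓐₀ ∣F) + (∣ 𝓑₁ ∣F + ∣ 𝓑₀ ∣F)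
    ≡⟨ cong ((∣ 𝓐₁ ∣F + ∣ 𝓐₀ ∣F) +_) (sym (∣∩F∣+∣∪F∣ 𝓑₁ 𝓑₀)) ⟩
  (∣ 𝓐₁ ∣F + ∣ 𝓐₀ ∣F) + (∣ 𝓑₁ ∩F 𝓑₀ ∣F + ∣ 𝓑₁ ∪F 𝓑₀ ∣F)
    ≡⟨ interchange (∣ 𝓐₁ ∣F) (∣ 𝓐₀ ∣F) (∣ 𝓑₁ ∩F 𝓑₀ ∣F) (∣ 𝓑₁ ∪F 𝓑₀ ∣F) ⟩
  (∣ 𝓐₁ ∣F + ∣ 𝓑₁ ∩F 𝓑₀ ∣F) + (∣ 𝓐₀ ∣F + ∣ 𝓑₁ ∪F 𝓑₀ ∣F)
    ≤⟨ +-mono-≤ link deletion ⟩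
  ∣ 𝓗 ↾ inside ∣F + ∣ 𝓗 ↾ outside ∣F
    ≡⟨ sym (∣∣F-↾ 𝓗) ⟩
  ∣ 𝓗 ∣F ∎
  where
  open ≤-Reasoning
  𝓐₀ 𝓐₁ 𝓑₀ 𝓑₁ : Family n
  𝓐₀ = 𝓐 ↾ outside
  𝓐₁ = 𝓐 ↾ inside
  𝓑₀ = 𝓑 ↾ outside
  𝓑₁ = 𝓑 ↾ inside

  link : ∣ 𝓐₁ ∣F + ∣ 𝓑₁ ∩F 𝓑₀ ∣F ≤ ∣ 𝓗 ↾ inside ∣F
  link = ∣𝓐∣+∣𝓑∣≤∣𝓗∣ (𝓗 ↾ inside) 𝓐₁ (𝓑₁ ∩F 𝓑₀) (Hereditary-↾ inside hered)
           (⊆F-↾ inside 𝓐⊆𝓗)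
           (λ X X∈𝓑₁∩𝓑₀ → 𝓑⊆𝓗 (inside ∷ X) (∩F-⊆Fˡ 𝓑₁ 𝓑₀ X X∈𝓑₁∩𝓑₀))
           (CrossIntersecting-⊆Fʳ (CrossIntersecting-↾ inside outside refl cross) (∩F-⊆Fʳ 𝓑₁ 𝓑₀))

  deletion : ∣ 𝓐₀ ∣F + ∣ 𝓑₁ ∪F 𝓑₀ ∣F ≤ ∣ 𝓗 ↾ outside ∣F
  deletion = ∣𝓐∣+∣𝓑∣≤∣𝓗∣ (𝓗 ↾ outside) 𝓐₀ (𝓑₁ ∪F 𝓑₀) (Hereditary-↾ outside hered)
               (⊆F-↾ outside 𝓐⊆𝓗)
               (∪F-least (λ X X∈𝓑₁ → ↾inside-⊆F-↾outside hered X (𝓑⊆𝓗 (inside ∷ X) X∈𝓑₁))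
                         (⊆F-↾ outside 𝓑⊆𝓗))
               (CrossIntersecting-∪F (CrossIntersecting-↾ outside inside refl cross)
                                     (CrossIntersecting-↾ outside outside refl cross))

star-CrossIntersecting : (𝓗 : Family n) (y : Fin n) → CrossIntersecting (star 𝓗 y) (star 𝓗 y)
star-CrossIntersecting 𝓗 y X Y X∈𝓢 Y∈𝓢 =
  y , x∈p∩q⁺ ( lookup⇒[]= y X (∧-conicalʳ (𝓗 X) _ X∈𝓢)
             , lookup⇒[]= y Y (∧-conicalʳ (𝓗 Y) _ Y∈𝓢))

corollary3p9 : (n : ℕ) → 1 ≤ n → (𝓗 𝓢 : Family n) →
    Hereditary 𝓗 → Σ (Subset n) (λ X → X ∈F 𝓗) →
    ¬ (∀ X → (X ∈F 𝓗) ⇔ (X ≡ ⊥)) →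
    IsLargestStar 𝓗 𝓢 →
    ((2 * ∣ 𝓢 ∣F ≤ ∣ 𝓗 ∣F) →
      (CrossIntersecting 𝓗 ∅F ×
       (∀ 𝓐₁ 𝓐₂ → 𝓐₁ ⊆F 𝓗 → 𝓐₂ ⊆F 𝓗 → CrossIntersecting 𝓐₁ 𝓐₂ →
         ∣ 𝓐₁ ∣F + ∣ 𝓐₂ ∣F ≤ ∣ 𝓗 ∣F + ∣ ∅F {n} ∣F)))
    ×
    ((∣ 𝓗 ∣F ≤ 2 * ∣ 𝓢 ∣F) →
      (CrossIntersecting 𝓢 𝓢 ×
       (∀ 𝓐₁ 𝓐₂ → 𝓐₁ ⊆F 𝓗 → 𝓐₂ ⊆F 𝓗 → CrossIntersecting 𝓐₁ 𝓐₂ →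
         ∣ 𝓐₁ ∣F + ∣ 𝓐₂ ∣F ≤ ∣ 𝓢 ∣F + ∣ 𝓢 ∣F)))
corollary3p9 n _ 𝓗 𝓢 hered _ _ (y , 𝓢≡star , _) =
  (λ _ → (λ _ _ _ ())
       , λ 𝓐₁ 𝓐₂ 𝓐₁⊆𝓗 𝓐₂⊆𝓗 cross →
           ≤-trans (∣𝓐∣+∣𝓑∣≤∣𝓗∣ 𝓗 𝓐₁ 𝓐₂ hered 𝓐₁⊆𝓗 𝓐₂⊆𝓗 cross) (m≤m+n _ _))
  , (λ ∣𝓗∣≤2∣𝓢∣ → 𝓢-CrossIntersecting
       , λ 𝓐₁ 𝓐₂ 𝓐₁⊆𝓗 𝓐₂⊆𝓗 cross →
           ≤-trans (∣𝓐∣+∣𝓑∣≤∣𝓗∣ 𝓗 𝓐₁ 𝓐₂ hered 𝓐₁⊆𝓗 𝓐₂⊆𝓗 cross)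
                   (≤-trans ∣𝓗∣≤2∣𝓢∣ (≤-reflexive (cong (∣ 𝓢 ∣F +_) (+-identityʳ _)))))
  where
  𝓢-CrossIntersecting : CrossIntersecting 𝓢 𝓢
  𝓢-CrossIntersecting X Y X∈𝓢 Y∈𝓢 =
    star-CrossIntersecting 𝓗 y X Y (trans (sym (𝓢≡star X)) X∈𝓢) (trans (sym (𝓢≡star Y)) Y∈𝓢)
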